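{- Let $P=(D,C)$ be a well-formed program of Core Choreographies with $C\neq\mathsf{end}$. Then for every state $s$ there exist an observable label $\lambda$ and a configuration $c'$ such that $(P,s)\xrightarrow{\lambda}c'$.
   Context: Fix types with decidable equality of process names $\mathsf{Pid}$, variables $\mathsf{Var}$, values $\mathsf{Val}$, expressions, Boolean expressions, procedure names $\mathsf{RecVar}$, annotations, and evaluation functions $\mathrm{eval}$ (expression and local state $\mathsf{Var}\to\mathsf{Val}$ to value) and $\mathrm{beval}$ (Boolean expression and local state to Boolean), invariant under extensional equality of local states. Labels: $\mathsf{left},\mathsf{right}$. A state is $s:\mathsf{Pid}\to\mathsf{Var}\to\mathsf{Val}$; $s\equiv s'$ is extensional equality; $s[q,x\mapsto v]$ is update. Interactions $\eta::=p.e\to q.x\mid p\to q[l]$ (processes $\{p,q\}$); choreographies $C::=\eta@a;C\mid\mathsf{if}\ p.b\ \mathsf{then}\ C_1\ \mathsf{else}\ C_2\mid\mathsf{call}\ X\mid\mathsf{rtcall}\ X\ ps\ C\mid\mathsf{end}$, $ps$ a list of processes. $D:\mathsf{RecVar}\to\mathrm{list}(\mathsf{Pid})\times\mathsf{Chor}$, $D\,X=(\mathrm{Vars}\,X,\mathrm{Body}\,X)$; a program is $(D,C)$, a configuration is a pair (program, state). Rich labels $\mathrm{com}(p,v,q,x),\mathrm{sel}(p,q,l),\mathrm{cond}(p),\mathrm{call}(X,p)$ with processes $\{p,q\},\{p,q\},\{p\},\{p\}$. $\langle C,s\rangle\xrightarrow{\rho}_D\langle C',s'\rangle$ is the least relation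 with: $\langle p.e\to q.x@a;C,s\rangle\xrightarrow{\mathrm{com}(p,v,q,x)}\langle C,s'\rangle$ if $v=\mathrm{eval}(e,s\,p)$, $s'\equiv s[q,x\mapsto v]$; $\langle p\to q[l]@a;C,s\rangle\xrightarrow{\mathrm{sel}(p,q,l)}\langle C,s'\rangle$ if $s\equiv s'$; $\langle\mathsf{if}\ p.b\ \mathsf{then}\ C_1\ \mathsf{else}\ C_2,s\rangle\xrightarrow{\mathrm{cond}(p)}\langle C_1,s'\rangle$ (resp. $C_2$) if $\mathrm{beval}(b,s\,p)$ is true (resp. false), $s\equiv s'$; $\langle\eta@a;C,s\rangle\xrightarrow{\rho}\langle\eta@a;C',s'\rangle$ if $\langle C,s\rangle\xrightarrow{\rho}\langle C',s'\rangle$ and processes of $\eta$, $\rho$ are disjoint; $\langle\mathsf{if}\ p.b\ \mathsf{then}\ C_1\ \mathsf{else}\ C_2,s\rangle\xrightarrow{\rho}\langle\mathsf{if}\ p.b\ \mathsf{then}\ C_1'\ \mathsf{else}\ C_2',s'\rangle$ if $p$ not in $\rho$ and $\langle C_i,s\rangle\xrightarrow{\rho}\langle C_i',s'\rangle$, $i=1,2$; $\langle\mathsf{rtcall}\ X\ ps\ C,s\rangle\xrightarrow{\rho}\langle\mathsf{rtcall}\ X\ ps\ C',s'\rangle$ if no process of $\rho$ is in $ps$ and $\langle C,s\rangle\xrightarrow{\rho}\langle C',s'\rangle$; for $s\equiv s'$, $p\in\mathrm{Vars}\,X$: $\langle\mathsf{call}\ X,s\rangle\xrightarrow{\mathrm{call}(X,p)}\langle\mathrm{Body}\,X,s'\rangle$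 if $\#\mathrm{Vars}\,X=1$, and $\langle\mathsf{rtcall}\ X\ (\mathrm{Vars}\,X\setminus p)\ (\mathrm{Body}\,X),s'\rangle$ if $\#\mathrm{Vars}\,X>1$; for $s\equiv s'$, $p\in ps$: $\langle\mathsf{rtcall}\ X\ ps\ C,s\rangle\xrightarrow{\mathrm{call}(X,p)}\langle\mathsf{rtcall}\ X\ (ps\setminus p)\ C,s'\rangle$ if $\#ps>1$ and $\langle C,s'\rangle$ if $\#ps=1$ ($\#$ is list size, $\setminus p$ removes $p$). Observable labels: $\mathrm{forget}(\mathrm{com}(p,v,q,x))=\mathrm{com}(p,v,q)$, $\mathrm{forget}(\mathrm{sel}(p,q,l))=\mathrm{sel}(p,q,l)$, $\mathrm{forget}(\mathrm{cond}(p))=\mathrm{forget}(\mathrm{call}(X,p))=\tau(p)$; $((D,C),s)\xrightarrow{\mathrm{forget}(\rho)}((D,C'),s')$ iff $\langle C,s\rangle\xrightarrow{\rho}_D\langle C',s'\rangle$. Well-formedness of $(D,C)$: $C$ contains no self-interaction ($p.e\to p.x$ or $p\to p[l]$), every $\mathsf{rtcall}\ X\ ps\ C'$ in $C$ has $ps$ nonempty with $ps\subseteq\mathrm{Vars}\,X$; for every $X$, $\mathrm{Body}\,X$ contains no self-interaction and no $\mathsf{rtcall}$, $\mathrm{Vars}\,X$ is nonempty, and every process occurring in $\mathrm{Body}\,X$ (counting, for each $\mathsf{call}\ Y$ in it, the processes of $\mathrm{Vars}\,Y$) is in $\mathrm{Vars}\,X$. -}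

module Defs where

open import Data.Bool using (Bool; true; false)
open import Data.Nat using (ℕ; _<_)
open import Data.List using (List; []; _∷_; _++_; length)
open import Data.List.Membership.Propositional using (_∈_; _∉_)
open import Data.Product using (_×_; _,_; proj₁; proj₂; Σ)
open import Data.Empty using (⊥)
open import Data.Unit using (⊤)
open import Relation.Nullary using (¬_; yes; no)
open import Relation.Binary.Definitions using (DecidableEquality)
open import Relation.Binary.PropositionalEquality using (_≡_; _≢_)

record Sig : Set₁ where
  field
    Pid Var Val Expr BExpr RecVar Ann : Set
    _≟Pid_    : DecidableEquality Pid
    _≟Var_    : DecidableEquality Var
    _≟Val_    : DecidableEquality Val
    _≟Expr_   : DecidableEquality Expr
    _≟BExpr_  : DecidableEquality BExpr
    _≟RecVar_ : DecidableEquality RecVar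
    _≟Ann_    : DecidableEquality Ann
    eval  : Expr → (Var → Val) → Val
    beval : BExpr → (Var → Val) → Bool
    eval-ext  : ∀ e (f g : Var → Val) → (∀ x → f x ≡ g x) → eval e f ≡ eval e g
    beval-ext : ∀ b (f g : Var → Val) → (∀ x → f x ≡ g x) → beval b f ≡ beval b g

data SelLabel : Set where
  left right : SelLabel

module Core (S : Sig) where
  open Sig S

  data Interaction : Set where
    com : Pid → Expr → Pid → Var → Interaction
    sel : Pid → Pid → SelLabel → Interaction

  infixr 5 _at_⨾_
  data Chor : Set where
    _at_⨾_ : Interaction → Ann → Chor → Chor
    cond   : Pid → BExpr → Chor → Chor → Chor
    call   : RecVar → Chor
    rtcall : RecVar → List Pid → Chor → Chor
    end    : Chor

  ProcDefs : Set
  ProcDefs = RecVar → List Pid × Chor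

  Program : Set
  Program = ProcDefs × Chor

  State : Set
  State = Pid → Var → Val

  Config : Set
  Config = Program × State

  _≡ₛ_ : State → State → Set
  s ≡ₛ s' = ∀ p x → s p x ≡ s' p x

  update : State → Pid → Var → Val → State
  update s q x v p y with p ≟Pid q | y ≟Var x
  ... | yes _ | yes _ = v
  ... | _     | _     = s p y

  remove : Pid → List Pid → List Pid
  remove p [] = []
  remove p (r ∷ ps) with r ≟Pid p
  ... | yes _ = ps
  ... | no _  = r ∷ remove p ps

  data RichLabel : Set where
    rcom  : Pid → Val → Pid → Var → RichLabel
    rsel  : Pid → Pid → SelLabel → RichLabel
    rcond : Pid → RichLabel
    rcall : RecVar → Pid → RichLabel

  data ObsLabel : Set where
    ocom : Pid → Val → Pid → ObsLabel
    osel : Pid → Pid → SelLabel → ObsLabel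
    τ    : Pid → ObsLabel

  forget : RichLabel → ObsLabel
  forget (rcom p v q x) = ocom p v q
  forget (rsel p q l)   = osel p q l
  forget (rcond p)      = τ p
  forget (rcall X p)    = τ p

  pnη : Interaction → List Pid
  pnη (com p e q x) = p ∷ q ∷ []
  pnη (sel p q l)   = p ∷ q ∷ []

  pnρ : RichLabel → List Pid
  pnρ (rcom p v q x) = p ∷ q ∷ []
  pnρ (rsel p q l)   = p ∷ q ∷ []
  pnρ (rcond p)      = p ∷ []
  pnρ (rcall X p)    = p ∷ []

  module _ (D : ProcDefs) where
    Vars : RecVar → List Pid
    Vars X = proj₁ (D X)

    Body : RecVar → Chor
    Body X = proj₂ (D X)

    data Step : Chor → State → RichLabel → Chor → State → Set where
      s-com : ∀ {p e q x a C s s' v} → v ≡ eval e (s p) → s' ≡ₛ update s q x v →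
              Step (com p e q x at a ⨾ C) s (rcom p v q x) C s'
      s-sel : ∀ {p q l a C s s'} → s ≡ₛ s' →
              Step (sel p q l at a ⨾ C) s (rsel p q l) C s'
      s-then : ∀ {p b C₁ C₂ s s'} → beval b (s p) ≡ true → s ≡ₛ s' →
               Step (cond p b C₁ C₂) s (rcond p) C₁ s'
      s-else : ∀ {p b C₁ C₂ s s'} → beval b (s p) ≡ false → s ≡ₛ s' →
               Step (cond p b C₁ C₂) s (rcond p) C₂ s'
      s-delay-η : ∀ {η a C C' s s' ρ} →
                  (∀ r → r ∈ pnη η → r ∉ pnρ ρ) → Step C s ρ C' s' →
                  Step (η at a ⨾ C) s ρ (η at a ⨾ C') s'
      s-delay-cond : ∀ {p b C₁ C₂ C₁' C₂' s s' ρ} → p ∉ pnρ ρ →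
                     Step C₁ s ρ C₁' s' → Step C₂ s ρ C₂' s' →
                     Step (cond p b C₁ C₂) s ρ (cond p b C₁' C₂') s'
      s-delay-rt : ∀ {X ps C C' s s' ρ} → (∀ r → r ∈ pnρ ρ → r ∉ ps) →
                   Step C s ρ C' s' →
                   Step (rtcall X ps C) s ρ (rtcall X ps C') s'
      s-call-1 : ∀ {X p s s'} → s ≡ₛ s' → p ∈ Vars X → length (Vars X) ≡ 1 →
                 Step (call X) s (rcall X p) (Body X) s'
      s-call-n : ∀ {X p s s'} → s ≡ₛ s' → p ∈ Vars X → 1 < length (Vars X) →
                 Step (call X) s (rcall X p) (rtcall X (remove p (Vars X)) (Body X)) s'
      s-rt-n : ∀ {X ps C p s s'} → s ≡ₛ s' → p ∈ ps → 1 < length ps →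
               Step (rtcall X ps C) s (rcall X p) (rtcall X (remove p ps) C) s'
      s-rt-1 : ∀ {X ps C p s s'} → s ≡ₛ s' → p ∈ ps → length ps ≡ 1 →
               Step (rtcall X ps C) s (rcall X p) C s'

    pnC : Chor → List Pid
    pnC (η at a ⨾ C)      = pnη η ++ pnC C
    pnC (cond p b C₁ C₂)  = p ∷ (pnC C₁ ++ pnC C₂)
    pnC (call Y)          = Vars Y
    pnC (rtcall Y ps C)   = ps ++ pnC C
    pnC end               = []

    RtOK : Chor → Set
    RtOK (η at a ⨾ C)     = RtOK C
    RtOK (cond p b C₁ C₂) = RtOK C₁ × RtOK C₂
    RtOK (call Y)         = ⊤
    RtOK (rtcall Y ps C)  = (ps ≢ []) × (∀ r → r ∈ ps → r ∈ Vars Y) × RtOK C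
    RtOK end              = ⊤

  NoSelfη : Interaction → Set
  NoSelfη (com p e q x) = p ≢ q
  NoSelfη (sel p q l)   = p ≢ q

  NoSelf : Chor → Set
  NoSelf (η at a ⨾ C)     = NoSelfη η × NoSelf C
  NoSelf (cond p b C₁ C₂) = NoSelf C₁ × NoSelf C₂
  NoSelf (call Y)         = ⊤
  NoSelf (rtcall Y ps C)  = NoSelf C
  NoSelf end              = ⊤

  NoRt : Chor → Set
  NoRt (η at a ⨾ C)     = NoRt C
  NoRt (cond p b C₁ C₂) = NoRt C₁ × NoRt C₂
  NoRt (call Y)         = ⊤
  NoRt (rtcall Y ps C)  = ⊥
  NoRt end              = ⊤

  WellFormed : Program → Set
  WellFormed (D , C) =
    NoSelf C × RtOK D C ×
    (∀ X → NoSelf (Body D X) × NoRt (Body D X) × (Vars D X ≢ []) ×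
           (∀ r → r ∈ pnC D (Body D X) → r ∈ Vars D X))

  data _─[_]→_ : Config → ObsLabel → Config → Set where
    obs : ∀ {D C C' s s' ρ} → Step D C s ρ C' s' →
          ((D , C) , s) ─[ forget ρ ]→ ((D , C') , s')

module Submission where

open import Defs
open import Data.Product using (Σ; _,_; _×_)
open import Relation.Binary.PropositionalEquality using (_≢_; _≡_; refl)
open import Data.Bool using (true; false)
open import Data.List using (List; []; _∷_; length)
open import Data.List.Membership.Propositional using (_∈_)
open import Data.List.Relation.Unary.Any using (here)
open import Data.Nat using (_<_; s≤s; z≤n)
open import Data.Sum using (_⊎_; inj₁; inj₂)
open import Data.Empty using (⊥-elim)

-- No out-of-order (delay) step is needed: the head of a non-terminated choreography
-- can always fire itself. Interactions and conditionals are unconditionally enabled,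
-- and a call or runtime call can be entered by any process of its (remaining)
-- parameter list, which is non-empty by well-formedness.

head-∈-with-length : {A : Set} (xs : List A) → xs ≢ [] →
                     Σ A λ x → x ∈ xs × (length xs ≡ 1 ⊎ 1 < length xs)
head-∈-with-length []           xs≢[] = ⊥-elim (xs≢[] refl)
head-∈-with-length (x ∷ [])     _     = x , here refl , inj₁ refl
head-∈-with-length (x ∷ _ ∷ _)  _     = x , here refl , inj₂ (s≤s (s≤s z≤n))

module _ (S : Sig) where
  open Sig S
  open Core S

  ≡ₛ-refl : (s : State) → s ≡ₛ s
  ≡ₛ-refl s _ _ = refl

  Reduces : ProcDefs → Chor → State → Set
  Reduces D C s = Σ RichLabel λ ρ → Σ Chor λ C' → Σ State λ s' → Step D C s ρ C' s'

  call-reduces : (D : ProcDefs) (X : RecVar) (s : State) →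
                 Vars D X ≢ [] → Reduces D (call X) s
  call-reduces D X s Vars≢[] with head-∈-with-length (Vars D X) Vars≢[]
  ... | p , p∈ , inj₁ one  = _ , _ , _ , s-call-1 (≡ₛ-refl s) p∈ one
  ... | p , p∈ , inj₂ more = _ , _ , _ , s-call-n (≡ₛ-refl s) p∈ more

  rtcall-reduces : (D : ProcDefs) (X : RecVar) (ps : List Pid) (C : Chor) (s : State) →
                   ps ≢ [] → Reduces D (rtcall X ps C) s
  rtcall-reduces D X ps C s ps≢[] with head-∈-with-length ps ps≢[]
  ... | p , p∈ , inj₁ one  = _ , _ , _ , s-rt-1 (≡ₛ-refl s) p∈ one
  ... | p , p∈ , inj₂ more = _ , _ , _ , s-rt-n (≡ₛ-refl s) p∈ more

  wellFormed⇒Vars≢[] : (D : ProcDefs) (C : Chor) → WellFormed (D , C) →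
                       ∀ X → Vars D X ≢ []
  wellFormed⇒Vars≢[] D C (_ , _ , wfDefs) X with wfDefs X
  ... | _ , _ , Vars≢[] , _ = Vars≢[]

  progress : (D : ProcDefs) (C : Chor) (s : State) →
             (∀ X → Vars D X ≢ []) → RtOK D C → C ≢ end → Reduces D C s
  progress D (com p e q x at _ ⨾ _) s _ _ _ =
    _ , _ , _ , s-com refl (≡ₛ-refl (update s q x (eval e (s p))))
  progress D (sel _ _ _ at _ ⨾ _) s _ _ _ = _ , _ , _ , s-sel (≡ₛ-refl s)
  progress D (cond p b _ _) s _ _ _ with beval b (s p) in b≡
  ... | true  = _ , _ , _ , s-then b≡ (≡ₛ-refl s)
  ... | false = _ , _ , _ , s-else b≡ (≡ₛ-refl s)
  progress D (call X) s Vars≢[] _ _ = call-reduces D X s (Vars≢[] X)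
  progress D (rtcall X ps C) s _ (ps≢[] , _) _ = rtcall-reduces D X ps C s ps≢[]
  progress D end s _ _ C≢end = ⊥-elim (C≢end refl)

mainTheorem3 : (S : Sig) (D : Core.ProcDefs S) (C : Core.Chor S) →
    Core.WellFormed S (D , C) → C ≢ Core.end →
    (s : Core.State S) →
    Σ (Core.ObsLabel S) λ l → Σ (Core.Config S) λ c' →
    Core._─[_]→_ S ((D , C) , s) l c'
mainTheorem3 S D C wf@(_ , rtOK , _) C≢end s
  with progress S D C s (wellFormed⇒Vars≢[] S D C wf) rtOK C≢end
... | ρ , C' , s' , step = Core.forget S ρ , ((D , C') , s') , Core.obs step
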